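{- Let $(R,+,\times)$ be a finite ring with identity of order $n$, and let $G$ be a subgroup of the multiplicative monoid $(R,\times)$ with $k=|G|$, satisfying $$(G-1)\setminus\{0\}\subseteq R^\times,$$ where $G-1=\{g-1\mid g\in G\}$ and $R^\times$ is the set of invertible elements of $R$. Let $D_G=\{rG\mid r\in R\}$ with $rG=\{rg\mid g\in G\}$, let $h_G:D_G\to\mathbb{Z}_{|D_G|}$ be a bijection, and define $f_G:R\to\mathbb{Z}_{|D_G|}$ by $f_G(x)=h_G(rG)$ whenever $x\in rG$. (Under these hypotheses $f_G$ is well defined and is an $(n,\frac{n-1}{k}+1,k-1)$ zero-difference balanced function.) Define $$f_G^0(x)=\begin{cases} f_G(x), & x\neq 0,\\ f_G(1), & x=0.\end{cases}$$ Then $f_G^0$ is an $(n,\frac{n-1}{k},S)$ zero-difference function, where $$S=\begin{cases} \{n\}, & \frac{n-1}{k}=1,\\ \{k\}, & \frac{n-1}{k}=2 \text{ and } -1\notin G,\\ \{k-1,k\}, & \frac{n-1}{k}>2 \text{ and } -1\notin G,\\ \{k-1,k+1\}, & \frac{n-1}{k}\ge 2 \text{ and } -1\in G. \end{cases}$$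
   Context: For finite abelian groups $(A,+)$, $(B,+)$ and a function $f:A\to B$, put $n=|A|$, $m=|f(A)|$ and, for $\alpha\in A\setminus\{0\}$, $\lambda_\alpha=|\{x\in A\mid f(x+\alpha)=f(x)\}|$. The function $f$ is called an $(n,m,S)$ zero-difference (ZD) function if $S=\{\lambda_\alpha\mid \alpha\in A\setminus\{0\}\}$ (as a set). It is an $(n,m,\lambda)$ zero-difference balanced (ZDB) function if $S=\{\lambda\}$ for a single integer $\lambda$. -}

module Defs where

open import Data.Nat using (ℕ; zero; suc; _<_; _≤_; NonZero; >-nonZero)
open import Data.Nat.Properties using (≤-<-trans; _≤?_)
open import Data.Bool using (Bool; true; false; if_then_else_)
open import Data.Fin using (Fin)
open import Data.Fin.Properties using (_≟_; any?)
open import Data.Fin.Subset using (Subset; _∈_; _∉_; ∣_∣; _-_)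
open import Data.Fin.Subset.Properties using (_∈?_; x∈p⇒∣p-x∣<∣p∣)
open import Data.Vec using (tabulate)
open import Data.Vec.Properties using (≡-dec)
open import Data.Bool.Properties using () renaming (_≟_ to _≟ᵇ_)
open import Data.List using (List)
import Data.List.Membership.Propositional as LM
open import Data.Product using (Σ; ∃; _×_; _,_)
open import Relation.Nullary using (Dec; does; ¬_)
open import Relation.Nullary.Decidable using (True; fromWitness; _×-dec_)
open import Relation.Binary.PropositionalEquality using (_≡_; _≢_; refl)
open import Algebra.Core using (Op₁; Op₂)
open import Algebra.Structures using (IsRing)
open import Function.Bundles using (_⇔_; _⤖_; Bijection)

-- A finite ring with identity of order n, presented on the carrier Fin n
-- (every finite ring of order n is isomorphic to one of this form).

record FinRing (n : ℕ) : Set where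
  field
    _+_ _*_ : Op₂ (Fin n)
    -_      : Op₁ (Fin n)
    0# 1#   : Fin n
    isRing  : IsRing _≡_ _+_ _*_ -_ 0# 1#
  infixl 6 _+_
  infixl 7 _*_
  infix  8 -_

  Invertible : Fin n → Set
  Invertible u = ∃ λ v → (u * v ≡ 1#) × (v * u ≡ 1#)

count : ∀ {n p} {P : Fin n → Set p} → (∀ x → Dec (P x)) → ℕ
count P? = ∣ tabulate (λ x → does (P? x)) ∣

module _ {n : ℕ} (R : FinRing n) where
  open FinRing R

  imageSize : ∀ {d} → (Fin n → Fin d) → ℕ
  imageSize f = count (λ y → any? (λ x → f x ≟ y))

  lam : ∀ {d} → (Fin n → Fin d) → Fin n → ℕ
  lam f α = count (λ x → f (x + α) ≟ f x)

  -- f is an (n, m, S) zero-difference function on (R,+), S given as a list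
  -- understood as a set:  |f(R)| = m  and  S = {λ_α | α ≠ 0}.
  IsZD : ∀ {d} → (Fin n → Fin d) → ℕ → List ℕ → Set
  IsZD f m S =
    (imageSize f ≡ m) ×
    (∀ t → (t LM.∈ S) ⇔ (∃ λ α → (α ≢ 0#) × (lam f α ≡ t)))

  record IsMulSubgroup (G : Subset n) : Set where
    field
      one∈G  : 1# ∈ G
      *-closed : ∀ {g h} → g ∈ G → h ∈ G → g * h ∈ G
      inv∈G  : ∀ {g} → g ∈ G → ∃ λ g' → (g' ∈ G) × (g * g' ≡ 1#) × (g' * g ≡ 1#)

  Cond : Subset n → Set
  Cond G = ∀ g → g ∈ G → g + - 1# ≢ 0# → Invertible (g + - 1#)

  coset : Subset n → Fin n → Subset n
  coset G r = tabulate (λ x → does (any? (λ g → (g ∈? G) ×-dec (r * g ≟ x))))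

  -- D_G = {rG | r ∈ R}, as a type of subsets (membership proof is irrelevant)
  D : Subset n → Set
  D G = Σ (Subset n) (λ S → True (any? (λ r → ≡-dec _≟ᵇ_ (coset G r) S)))

  -- f_G(x) = h_G(rG) for x ∈ rG; we use r = x (x ∈ xG since 1 ∈ G, and
  -- cosets of the subgroup G partition R, so this is the same function)
  fG : ∀ {d} (G : Subset n) → D G ⤖ Fin d → Fin n → Fin d
  fG G h x = Bijection.to h (coset G x , fromWitness (x , refl))

  fG0 : ∀ {d} (G : Subset n) → D G ⤖ Fin d → Fin n → Fin d
  fG0 G h x = if does (x ≟ 0#) then fG G h 1# else fG G h x

  sizeNZ : ∀ {G} → IsMulSubgroup G → NonZero ∣ G ∣
  sizeNZ {G} sg = >-nonZero (≤-<-trans (Data.Nat.z≤n) (x∈p⇒∣p-x∣<∣p∣ (IsMulSubgroup.one∈G sg)))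

-- Right multiplication by G acts freely on R ∖ {0}: if y c = y with c ≠ 1, then c − 1 is a unit
-- and y = 0. Hence every nonzero coset xG has exactly k = |G| elements, f_G^0 is the coset map
-- on R ∖ {0}, and counting R ∖ {0} fibre by fibre gives |f_G^0(R)| · k = n − 1. For α ≠ 0 the
-- solutions of f_G^0(x + α) = f_G^0(x) are x = 0 (present iff α ∈ G), x = −α (iff −α ∈ G), and
-- the nonzero x with x + α ∈ xG; the last ones correspond bijectively to g ∈ G ∖ {1} via
-- x(g − 1) = α. So λ_α = (k − 1) + [−α ∈ G] + [α ∈ G], and the four cases reduce to deciding
-- which of these values occur: a nonzero α outside G exists iff the image has at least two
-- values, and (when −1 ∉ G) a nonzero α with α, −α ∉ G exists iff it has at least three.

module Submission where

open import Defs
open import Level using (Level; 0ℓ)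
open import Data.Nat as ℕ using (ℕ; _∸_; _<_; _≤_; NonZero; >-nonZero⁻¹)
import Data.Nat.Properties as ℕₚ
open ℕₚ using (≤-antisym; ≤-reflexive; <⇒≱; n≤0⇒n≡0; m+n∸n≡m; m∸n+n≡m)
open import Data.Nat.DivMod using (_/_; m*n/n≡m)
open import Data.Bool using (true; false)
open import Data.Bool.Properties using (T-irrelevant)
open import Data.Fin using (Fin; zero; suc)
open import Data.Fin.Patterns using (0F; 1F; 2F)
open import Data.Fin.Properties using (_≟_; any?; nonZeroIndex; injective⇒≤; suc-injective)
open import Data.Fin.Subset using (Subset; _∈_; _∉_; ∣_∣)
open import Data.Fin.Subset.Properties using (_∈?_)
open import Data.Vec using (_∷_; []; tabulate)
open import Data.Vec.Properties using (lookup∘tabulate; tabulate-cong; []=⇒lookup; lookup⇒[]=)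
open import Data.List using (_∷_; [])
open import Data.List.Membership.Propositional using () renaming (_∈_ to _∈ₗ_)
open import Data.List.Relation.Unary.Any using (here; there)
open import Data.Product using (∃; _×_; _,_; proj₁; proj₂; swap)
open import Data.Sum as ⊎ using (_⊎_; inj₁; inj₂; [_,_]; [_,_]′)
open import Data.Unit using (tt)
open import Relation.Nullary using (Dec; yes; no; does; proof; ¬_; contradiction)
open import Relation.Nullary.Reflects using (Reflects; invert)
open import Relation.Nullary.Decidable
  using (_⊎-dec_; _×-dec_; ¬?; dec-true; does-⇔; decidable-stable)
open import Relation.Unary using (Pred; Decidable)
open import Relation.Unary.Properties using (U?)
open import Relation.Binary.PropositionalEquality
  using (_≡_; _≢_; refl; sym; trans; cong; cong₂; subst; module ≡-Reasoning)
open import Function using (_∘_; flip; _⇔_; mk⇔; Equivalence; Injective; _⤖_; Bijection)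
import Function.Properties.Equivalence as ⇔
open Equivalence using (to; from)
open import Algebra.Bundles using (Ring)
import Algebra.Properties.Ring as RingProperties
open import Algebra.Properties.Semiring.Sum ℕₚ.+-*-semiring
  using (sum-syntax; ∑-distrib-+; ∑-comm; sum-cong-≗; *-distribʳ-sum)

private variable
  ℓ ℓ′ : Level

module Counting where

  open import Data.Nat using (zero; suc; _+_)

  𝟙 : {P : Set ℓ} → Dec P → ℕ
  𝟙 (yes _) = 1
  𝟙 (no _)  = 0

  𝟙-yes : {P : Set ℓ} (P? : Dec P) → P → 𝟙 P? ≡ 1
  𝟙-yes (yes _) _ = refl
  𝟙-yes (no ¬p) p = contradiction p ¬p

  𝟙-no : {P : Set ℓ} (P? : Dec P) → ¬ P → 𝟙 P? ≡ 0
  𝟙-no (yes p) ¬p = contradiction p ¬p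
  𝟙-no (no _)  _  = refl

  𝟙-cong : {P : Set ℓ} {Q : Set ℓ′} (P? : Dec P) (Q? : Dec Q) → P ⇔ Q → 𝟙 P? ≡ 𝟙 Q?
  𝟙-cong (yes _) (yes _) _   = refl
  𝟙-cong (yes p) (no ¬q) P⇔Q = contradiction (to P⇔Q p) ¬q
  𝟙-cong (no ¬p) (yes q) P⇔Q = contradiction (from P⇔Q q) ¬p
  𝟙-cong (no _)  (no _)  _   = refl

  𝟙-⊎ : {P : Set ℓ} {Q : Set ℓ′} (P? : Dec P) (Q? : Dec Q) → ¬ (P × Q) →
        𝟙 (P? ⊎-dec Q?) ≡ 𝟙 P? + 𝟙 Q?
  𝟙-⊎ (yes p) (yes q) disjoint = contradiction (p , q) disjoint
  𝟙-⊎ (yes _) (no _)  _        = refl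
  𝟙-⊎ (no _)  (yes _) _        = refl
  𝟙-⊎ (no _)  (no _)  _        = refl

  count≡∑𝟙 : ∀ {n} {P : Pred (Fin n) ℓ} (P? : Decidable P) → count P? ≡ ∑[ x < n ] 𝟙 (P? x)
  count≡∑𝟙 {n = zero}  P? = refl
  count≡∑𝟙 {n = suc n} P? with P? zero
  ... | yes _ = cong suc (count≡∑𝟙 (P? ∘ suc))
  ... | no _  = count≡∑𝟙 (P? ∘ suc)

  record Enumeration {n} (P : Pred (Fin n) ℓ) (c : ℕ) : Set ℓ where
    field
      element           : Fin c → Fin n
      element-∈         : ∀ i → P (element i)
      element-injective : Injective _≡_ _≡_ element
      index             : ∀ x → P x → Fin c
      element∘index     : ∀ x (px : P x) → element (index x px) ≡ x

  enumeration : ∀ {n} {P : Pred (Fin n) ℓ} (P? : Decidable P) → Enumeration P (count P?)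
  enumeration {n = zero}  P? = record
    { element = λ () ; element-∈ = λ () ; element-injective = λ {} ; index = λ () ; element∘index = λ () }
  enumeration {n = suc n} P? with P? zero
  ... | yes p₀ = record
    { element           = λ { zero → zero ; (suc i) → suc (element i) }
    ; element-∈         = λ { zero → p₀ ; (suc i) → element-∈ i }
    ; element-injective = λ { {zero} {zero} _ → refl
                            ; {suc i} {suc j} e → cong suc (element-injective (suc-injective e)) }
    ; index             = λ { zero _ → zero ; (suc x) px → suc (index x px) }
    ; element∘index     = λ { zero _ → refl ; (suc x) px → cong suc (element∘index x px) }
    }
    where open Enumeration (enumeration (P? ∘ suc))
  ... | no ¬p₀ = record
    { element           = suc ∘ element
    ; element-∈         = element-∈
    ; element-injective = element-injective ∘ suc-injective
    ; index             = λ { zero p₀ → contradiction p₀ ¬p₀ ; (suc x) px → index x px }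
    ; element∘index     = λ { zero p₀ → contradiction p₀ ¬p₀ ; (suc x) px → cong suc (element∘index x px) }
    }
    where open Enumeration (enumeration (P? ∘ suc))

  count-≤-injection : ∀ {m n} {P : Pred (Fin m) ℓ} {Q : Pred (Fin n) ℓ′}
    (P? : Decidable P) (Q? : Decidable Q) (u : ∀ x → P x → Fin n) →
    (∀ x px → Q (u x px)) → (∀ x y px py → u x px ≡ u y py → x ≡ y) →
    count P? ≤ count Q?
  count-≤-injection P? Q? u u-∈ u-injective = injective⇒≤ F-injective
    where
    module EP = Enumeration (enumeration P?)
    module EQ = Enumeration (enumeration Q?)
    F : Fin (count P?) → Fin (count Q?)
    F i = EQ.index (u (EP.element i) (EP.element-∈ i)) (u-∈ _ _)
    F-injective : Injective _≡_ _≡_ F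
    F-injective {i} {j} Fi≡Fj = EP.element-injective (u-injective _ _ _ _ (begin
      u (EP.element i) _   ≡⟨ EQ.element∘index _ _ ⟨
      EQ.element (F i)     ≡⟨ cong EQ.element Fi≡Fj ⟩
      EQ.element (F j)     ≡⟨ EQ.element∘index _ _ ⟩
      u (EP.element j) _   ∎))
      where open ≡-Reasoning

  count-cong : ∀ {n} {P : Pred (Fin n) ℓ} {Q : Pred (Fin n) ℓ′}
    (P? : Decidable P) (Q? : Decidable Q) → (∀ x → P x ⇔ Q x) → count P? ≡ count Q?
  count-cong {n = n} P? Q? P⇔Q = begin
    count P?              ≡⟨ count≡∑𝟙 P? ⟩
    ∑[ x < n ] 𝟙 (P? x)   ≡⟨ sum-cong-≗ (λ x → 𝟙-cong (P? x) (Q? x) (P⇔Q x)) ⟩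
    ∑[ x < n ] 𝟙 (Q? x)   ≡⟨ count≡∑𝟙 Q? ⟨
    count Q?              ∎
    where open ≡-Reasoning

  count-⊎ : ∀ {n} {P : Pred (Fin n) ℓ} {Q : Pred (Fin n) ℓ′}
    (P? : Decidable P) (Q? : Decidable Q) → (∀ x → ¬ (P x × Q x)) →
    count (λ x → P? x ⊎-dec Q? x) ≡ count P? + count Q?
  count-⊎ {n = n} P? Q? disjoint = begin
    count (λ x → P? x ⊎-dec Q? x)               ≡⟨ count≡∑𝟙 (λ x → P? x ⊎-dec Q? x) ⟩
    ∑[ x < n ] 𝟙 (P? x ⊎-dec Q? x)              ≡⟨ sum-cong-≗ (λ x → 𝟙-⊎ (P? x) (Q? x) (disjoint x)) ⟩
    ∑[ x < n ] (𝟙 (P? x) + 𝟙 (Q? x))            ≡⟨ ∑-distrib-+ (𝟙 ∘ P?) (𝟙 ∘ Q?) ⟩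
    ∑[ x < n ] 𝟙 (P? x) + ∑[ x < n ] 𝟙 (Q? x)   ≡⟨ cong₂ _+_ (count≡∑𝟙 P?) (count≡∑𝟙 Q?) ⟨
    count P? + count Q?                         ∎
    where open ≡-Reasoning

  count-U : ∀ {n} → count {n} U? ≡ n
  count-U {zero}  = refl
  count-U {suc n} = cong suc (count-U {n})

  count-∅ : ∀ {n} {P : Pred (Fin n) ℓ} (P? : Decidable P) → (∀ x → ¬ P x) → count P? ≡ 0
  count-∅ P? ∅ = n≤0⇒n≡0 (count-≤-injection P? (U? {A = Fin 0}) (λ x px → contradiction px (∅ x))
    (λ x px → contradiction px (∅ x)) (λ x _ px _ _ → contradiction px (∅ x)))

  count-unique : ∀ {n} {P : Pred (Fin n) ℓ} (P? : Decidable P) (c : Fin n) →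
    P c → (∀ x → P x → x ≡ c) → count P? ≡ 1
  count-unique P? c pc unique = ≤-antisym
    (count-≤-injection P? (U? {A = Fin 1}) (λ _ _ → zero) (λ _ _ → tt)
      (λ x y px py _ → trans (unique x px) (sym (unique y py))))
    (count-≤-injection (U? {A = Fin 1}) P? (λ _ _ → c) (λ _ _ → pc) (λ { zero zero _ _ _ → refl }))

  count-≡-× : ∀ {n} {Q : Set ℓ} (c : Fin n) (Q? : Dec Q) → count (λ x → (c ≟ x) ×-dec Q?) ≡ 𝟙 Q?
  count-≡-× c (yes q) = count-unique (λ x → (c ≟ x) ×-dec yes q) c (refl , q) (λ _ (c≡x , _) → sym c≡x)
  count-≡-× c (no ¬q) = count-∅ (λ x → (c ≟ x) ×-dec no ¬q) (λ _ (_ , q) → ¬q q)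

  count-split : ∀ {n} {P : Pred (Fin n) ℓ} (P? : Decidable P) (c : Fin n) →
    count P? ≡ count (λ x → P? x ×-dec ¬? (x ≟ c)) + 𝟙 (P? c)
  count-split {P = P} P? c = begin
    count P?
      ≡⟨ count-cong P? (λ x → P∖c? x ⊎-dec ((c ≟ x) ×-dec P? x)) split ⟩
    count (λ x → P∖c? x ⊎-dec ((c ≟ x) ×-dec P? x))
      ≡⟨ count-⊎ P∖c? (λ x → (c ≟ x) ×-dec P? x) (λ _ ((_ , x≢c) , (c≡x , _)) → x≢c (sym c≡x)) ⟩
    count P∖c? + count (λ x → (c ≟ x) ×-dec P? x)
      ≡⟨ cong (count P∖c? +_) (count-cong (λ x → (c ≟ x) ×-dec P? x) (λ x → (c ≟ x) ×-dec P? c)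
                                 (λ _ → mk⇔ (λ { (refl , p) → refl , p }) (λ { (refl , p) → refl , p }))) ⟩
    count P∖c? + count (λ x → (c ≟ x) ×-dec P? c)
      ≡⟨ cong (count P∖c? +_) (count-≡-× c (P? c)) ⟩
    count P∖c? + 𝟙 (P? c) ∎
    where
    open ≡-Reasoning
    P∖c? : ∀ x → Dec (P x × x ≢ c)
    P∖c? x = P? x ×-dec ¬? (x ≟ c)
    split : ∀ x → P x ⇔ ((P x × x ≢ c) ⊎ (c ≡ x × P x))
    split x = mk⇔ decide [ proj₁ , proj₂ ]
      where
      decide : P x → (P x × x ≢ c) ⊎ (c ≡ x × P x)
      decide px with x ≟ c
      ... | yes refl = inj₂ (refl , px)
      ... | no x≢c   = inj₁ (px , x≢c)

  count-≢ : ∀ {n} (c : Fin n) → count (λ x → ¬? (x ≟ c)) ≡ n ∸ 1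
  count-≢ {n} c = begin
    count (λ x → ¬? (x ≟ c))
      ≡⟨ count-cong (λ x → ¬? (x ≟ c)) (λ x → U? x ×-dec ¬? (x ≟ c)) (λ _ → mk⇔ (tt ,_) proj₂) ⟩
    count (λ x → U? x ×-dec ¬? (x ≟ c))           ≡⟨ m+n∸n≡m _ 1 ⟨
    count (λ x → U? x ×-dec ¬? (x ≟ c)) + 1 ∸ 1   ≡⟨ cong (_∸ 1) (count-split U? c) ⟨
    count {n} U? ∸ 1                              ≡⟨ cong (_∸ 1) (count-U {n}) ⟩
    n ∸ 1                                         ∎
    where open ≡-Reasoning

  ∑-count-fibres : ∀ {n d} {P : Pred (Fin n) ℓ} (P? : Decidable P) (f : Fin n → Fin d) →
    ∑[ y < d ] count (λ x → P? x ×-dec (f x ≟ y)) ≡ count P?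
  ∑-count-fibres {n = n} {d} P? f = begin
    ∑[ y < d ] count (λ x → P? x ×-dec (f x ≟ y))
      ≡⟨ sum-cong-≗ (λ y → count≡∑𝟙 (λ x → P? x ×-dec (f x ≟ y))) ⟩
    ∑[ y < d ] ∑[ x < n ] 𝟙 (P? x ×-dec (f x ≟ y))
      ≡⟨ ∑-comm (λ y x → 𝟙 (P? x ×-dec (f x ≟ y))) ⟩
    ∑[ x < n ] ∑[ y < d ] 𝟙 (P? x ×-dec (f x ≟ y))
      ≡⟨ sum-cong-≗ fibre-of ⟩
    ∑[ x < n ] 𝟙 (P? x)
      ≡⟨ count≡∑𝟙 P? ⟨
    count P?
      ∎
    where
    open ≡-Reasoning
    fibre-of : ∀ x → ∑[ y < d ] 𝟙 (P? x ×-dec (f x ≟ y)) ≡ 𝟙 (P? x)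
    fibre-of x = begin
      ∑[ y < d ] 𝟙 (P? x ×-dec (f x ≟ y))   ≡⟨ count≡∑𝟙 (λ y → P? x ×-dec (f x ≟ y)) ⟨
      count (λ y → P? x ×-dec (f x ≟ y))    ≡⟨ count-cong (λ y → P? x ×-dec (f x ≟ y))
                                                          (λ y → (f x ≟ y) ×-dec P? x) (λ _ → mk⇔ swap swap) ⟩
      count (λ y → (f x ≟ y) ×-dec P? x)    ≡⟨ count-≡-× (f x) (P? x) ⟩
      𝟙 (P? x)                              ∎

  ∣p∣≡count : ∀ {n} (p : Subset n) → ∣ p ∣ ≡ count (_∈? p)
  ∣p∣≡count p = cong ∣_∣ (sym (tabulate-∈? p))
    where
    tabulate-∈? : ∀ {n} (p : Subset n) → tabulate (λ x → does (x ∈? p)) ≡ p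
    tabulate-∈? []          = refl
    tabulate-∈? (true ∷ p)  = cong (true ∷_) (tabulate-∈? p)
    tabulate-∈? (false ∷ p) = cong (false ∷_) (tabulate-∈? p)

  ∈-tabulate⇔ : ∀ {n} {P : Pred (Fin n) ℓ} (P? : Decidable P) {x} →
    x ∈ tabulate (λ y → does (P? y)) ⇔ P x
  ∈-tabulate⇔ P? {x} = mk⇔
    (λ x∈ → invert (subst (Reflects _) (trans (sym (lookup∘tabulate _ x)) ([]=⇒lookup x∈))
                          (proof (P? x))))
    (λ px → lookup⇒[]= x _ (trans (lookup∘tabulate _ x) (dec-true (P? x) px)))

  image? : ∀ {n d} (f : Fin n → Fin d) → Decidable (λ y → ∃ λ x → f x ≡ y)
  image? f y = any? (λ x → f x ≟ y)

  module _ {n d} (f : Fin n → Fin d) where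

    injective⇒≤imageSize : ∀ {m} (xs : Fin m → Fin n) → Injective _≡_ _≡_ (f ∘ xs) → m ≤ count (image? f)
    injective⇒≤imageSize {m} xs injective = subst (_≤ count (image? f)) (count-U {m})
      (count-≤-injection U? (image? f) (λ i _ → f (xs i)) (λ i _ → xs i , refl) (λ _ _ _ _ → injective))

    covered⇒imageSize≤ : ∀ {m} (ys : Fin m → Fin d) → (∀ x → ∃ λ i → f x ≡ ys i) → count (image? f) ≤ m
    covered⇒imageSize≤ {m} ys covered = subst (count (image? f) ≤_) (count-U {m})
      (count-≤-injection (image? f) U? (λ _ (x , _) → proj₁ (covered x)) (λ _ _ → tt) injective)
      where
      injective : ∀ y y′ (p : ∃ λ x → f x ≡ y) (p′ : ∃ λ x → f x ≡ y′) →
                  proj₁ (covered (proj₁ p)) ≡ proj₁ (covered (proj₁ p′)) → y ≡ y′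
      injective _ _ (x , refl) (x′ , refl) i≡i′ =
        trans (proj₂ (covered x)) (trans (cong ys i≡i′) (sym (proj₂ (covered x′))))

    distinct⇒2≤imageSize : ∀ {a b} → f a ≢ f b → 2 ≤ count (image? f)
    distinct⇒2≤imageSize {a} {b} fa≢fb = injective⇒≤imageSize {2} (λ { 0F → a ; 1F → b })
      λ { {0F} {0F} _ → refl
        ; {0F} {1F} e → contradiction e fa≢fb
        ; {1F} {0F} e → contradiction (sym e) fa≢fb
        ; {1F} {1F} _ → refl }

    distinct⇒3≤imageSize : ∀ {a b c} → f a ≢ f b → f a ≢ f c → f b ≢ f c → 3 ≤ count (image? f)
    distinct⇒3≤imageSize {a} {b} {c} fa≢fb fa≢fc fb≢fc =
      injective⇒≤imageSize {3} (λ { 0F → a ; 1F → b ; 2F → c })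
      λ { {0F} {0F} _ → refl
        ; {0F} {1F} e → contradiction e fa≢fb
        ; {0F} {2F} e → contradiction e fa≢fc
        ; {1F} {0F} e → contradiction (sym e) fa≢fb
        ; {1F} {1F} _ → refl
        ; {1F} {2F} e → contradiction e fb≢fc
        ; {2F} {0F} e → contradiction (sym e) fa≢fc
        ; {2F} {1F} e → contradiction (sym e) fb≢fc
        ; {2F} {2F} _ → refl }

    constant⇒imageSize≤1 : ∀ {a} → (∀ x → f x ≡ f a) → count (image? f) ≤ 1
    constant⇒imageSize≤1 {a} ≡fa = covered⇒imageSize≤ {1} (λ _ → f a) (λ x → 0F , ≡fa x)

    two-valued⇒imageSize≤2 : ∀ {a b} → (∀ x → f x ≡ f a ⊎ f x ≡ f b) → count (image? f) ≤ 2
    two-valued⇒imageSize≤2 {a} {b} ≡fa⊎≡fb = covered⇒imageSize≤ {2} (λ { 0F → f a ; 1F → f b })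
      (λ x → [ (0F ,_) , (1F ,_) ]′ (≡fa⊎≡fb x))

open Counting

mkIsZD : ∀ {n} (R : FinRing n) {d} (f : Fin n → Fin d) {m S} → imageSize R f ≡ m →
  (∀ {α} → α ≢ FinRing.0# R → lam R f α ∈ₗ S) →
  (∀ {t} → t ∈ₗ S → ∃ λ α → α ≢ FinRing.0# R × lam R f α ≡ t) → IsZD R f m S
mkIsZD R f image lam∈S S⊆lams =
  image , λ t → mk⇔ S⊆lams λ (α , α≢0 , lam≡t) → subst (_∈ₗ _) lam≡t (lam∈S α≢0)

module SubgroupAction {n} (R : FinRing n) (G : Subset n) (G-subgroup : IsMulSubgroup R G)
  (G-1-invertible : Cond R G) where

  open FinRing R
  open IsMulSubgroup G-subgroup

  ring : Ring 0ℓ 0ℓ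
  ring = record { isRing = isRing }

  open Ring ring using (_-_; +-comm; -‿inverseʳ; *-assoc; *-identityˡ; *-identityʳ; zeroˡ; zeroʳ)
  open RingProperties ring using (x∙y⁻¹≈ε⇒x≈y; x≈y⇒x∙y⁻¹≈ε; //-rightDividesˡ; //-rightDividesʳ;
    x[y-z]≈xy-xz; -‿distribˡ-*; -‿involutive; -0#≈0#; -1*x≈-x)
  open ≡-Reasoning

  -‿≢0 : ∀ {x} → x ≢ 0# → - x ≢ 0#
  -‿≢0 {x} x≢0 -x≡0 = x≢0 (trans (sym (-‿involutive x)) (trans (cong -_ -x≡0) -0#≈0#))

  *[g-1]≡*g-x : ∀ x g → x * (g - 1#) ≡ x * g - x
  *[g-1]≡*g-x x g = trans (x[y-z]≈xy-xz x g 1#) (cong (λ z → x * g - z) (*-identityʳ x))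

  *≡+⇔*[g-1]≡ : ∀ {x g α} → x * g ≡ x + α ⇔ x * (g - 1#) ≡ α
  *≡+⇔*[g-1]≡ {x} {g} {α} = mk⇔
    (λ xg≡x+α → begin
      x * (g - 1#)   ≡⟨ *[g-1]≡*g-x x g ⟩
      x * g - x      ≡⟨ cong (_- x) (trans xg≡x+α (+-comm x α)) ⟩
      α + x - x      ≡⟨ //-rightDividesʳ x α ⟩
      α              ∎)
    (λ x[g-1]≡α → begin
      x * g          ≡⟨ //-rightDividesˡ x (x * g) ⟨
      x * g - x + x  ≡⟨ cong (_+ x) (trans (sym (*[g-1]≡*g-x x g)) x[g-1]≡α) ⟩
      α + x          ≡⟨ +-comm α x ⟩
      x + α          ∎)

  x*v≡a⇒x≡a*u : ∀ {x v u a} → x * v ≡ a → v * u ≡ 1# → x ≡ a * u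
  x*v≡a⇒x≡a*u {x} {v} {u} {a} xv≡a vu≡1 = begin
    x             ≡⟨ *-identityʳ x ⟨
    x * 1#        ≡⟨ cong (x *_) vu≡1 ⟨
    x * (v * u)   ≡⟨ *-assoc x v u ⟨
    x * v * u     ≡⟨ cong (_* u) xv≡a ⟩
    a * u         ∎

  inverse : ∀ {g} → g ∈ G → Fin n
  inverse g∈G = proj₁ (inv∈G g∈G)

  inverse-∈ : ∀ {g} (g∈G : g ∈ G) → inverse g∈G ∈ G
  inverse-∈ g∈G = proj₁ (proj₂ (inv∈G g∈G))

  *-inverseʳ : ∀ {g} (g∈G : g ∈ G) → g * inverse g∈G ≡ 1#
  *-inverseʳ g∈G = proj₁ (proj₂ (proj₂ (inv∈G g∈G)))

  *-inverse-cancelʳ : ∀ a {g} (g∈G : g ∈ G) → a * g * inverse g∈G ≡ a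
  *-inverse-cancelʳ a {g} g∈G = begin
    a * g * inverse g∈G     ≡⟨ *-assoc a g (inverse g∈G) ⟩
    a * (g * inverse g∈G)   ≡⟨ cong (a *_) (*-inverseʳ g∈G) ⟩
    a * 1#                  ≡⟨ *-identityʳ a ⟩
    a                       ∎

  infix 4 _∼_
  _∼_ : Fin n → Fin n → Set
  a ∼ b = ∃ λ g → g ∈ G × a * g ≡ b

  _∼?_ : ∀ a b → Dec (a ∼ b)
  a ∼? b = any? (λ g → (g ∈? G) ×-dec (a * g ≟ b))

  ∼-refl : ∀ a → a ∼ a
  ∼-refl a = 1# , one∈G , *-identityʳ a

  ∼-sym : ∀ {a b} → a ∼ b → b ∼ a
  ∼-sym {a} (g , g∈G , ag≡b) =
    inverse g∈G , inverse-∈ g∈G , trans (cong (_* inverse g∈G) (sym ag≡b)) (*-inverse-cancelʳ a g∈G)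

  ∼-trans : ∀ {a b c} → a ∼ b → b ∼ c → a ∼ c
  ∼-trans {a} (g , g∈G , ag≡b) (g′ , g′∈G , bg′≡c) =
    g * g′ , *-closed g∈G g′∈G , trans (sym (*-assoc a g g′)) (trans (cong (_* g′) ag≡b) bg′≡c)

  -‿∼ : ∀ {a b} → a ∼ b → - a ∼ - b
  -‿∼ {a} (g , g∈G , ag≡b) = g , g∈G , trans (sym (-‿distribˡ-* a g)) (cong -_ ag≡b)

  ∼-≢0 : ∀ {a b} → a ≢ 0# → a ∼ b → b ≢ 0#
  ∼-≢0 {a} {b} a≢0 a∼b b≡0 with ∼-sym a∼b
  ... | g , _ , bg≡a = a≢0 (begin
    a        ≡⟨ bg≡a ⟨
    b * g    ≡⟨ cong (_* g) b≡0 ⟩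
    0# * g   ≡⟨ zeroˡ g ⟩
    0#       ∎)

  1∼⇔∈G : ∀ {x} → 1# ∼ x ⇔ x ∈ G
  1∼⇔∈G {x} = mk⇔ (λ (g , g∈G , 1g≡x) → subst (_∈ G) (trans (sym (*-identityˡ g)) 1g≡x) g∈G)
                  (λ x∈G → x , x∈G , *-identityˡ x)

  ∼-1⇔-∈G : ∀ {a} → a ∼ - 1# ⇔ - a ∈ G
  ∼-1⇔-∈G {a} = mk⇔
    (λ a∼-1 → to 1∼⇔∈G (∼-sym (subst (- a ∼_) (-‿involutive 1#) (-‿∼ a∼-1))))
    (λ -a∈G → ∼-sym (subst (- 1# ∼_) (-‿involutive a) (-‿∼ (from 1∼⇔∈G -a∈G))))

  -1∈G⇒-∈G : - 1# ∈ G → ∀ {a} → a ∈ G → - a ∈ G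
  -1∈G⇒-∈G -1∈G {a} a∈G = subst (_∈ G) (-1*x≈-x a) (*-closed -1∈G a∈G)

  -∈G⇒-1∈G : ∀ {a} → a ∈ G → - a ∈ G → - 1# ∈ G
  -∈G⇒-1∈G a∈G -a∈G = to 1∼⇔∈G
    (∼-trans (from 1∼⇔∈G -a∈G) (-‿∼ (∼-sym (from 1∼⇔∈G a∈G))))

  g-1-inverse : ∀ {g} → g ∈ G → g ≢ 1# → Fin n
  g-1-inverse {g} g∈G g≢1 = proj₁ (G-1-invertible g g∈G (g≢1 ∘ x∙y⁻¹≈ε⇒x≈y g 1#))

  *-g-1-inverseʳ : ∀ {g} (g∈G : g ∈ G) (g≢1 : g ≢ 1#) → (g - 1#) * g-1-inverse g∈G g≢1 ≡ 1#
  *-g-1-inverseʳ {g} g∈G g≢1 = proj₁ (proj₂ (G-1-invertible g g∈G (g≢1 ∘ x∙y⁻¹≈ε⇒x≈y g 1#)))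

  *-g-1-inverseˡ : ∀ {g} (g∈G : g ∈ G) (g≢1 : g ≢ 1#) → g-1-inverse g∈G g≢1 * (g - 1#) ≡ 1#
  *-g-1-inverseˡ {g} g∈G g≢1 = proj₂ (proj₂ (G-1-invertible g g∈G (g≢1 ∘ x∙y⁻¹≈ε⇒x≈y g 1#)))

  fixed⇒≡1 : ∀ {y c} → y ≢ 0# → c ∈ G → y * c ≡ y → c ≡ 1#
  fixed⇒≡1 {y} {c} y≢0 c∈G yc≡y with c ≟ 1#
  ... | yes c≡1 = c≡1
  ... | no c≢1  = contradiction (trans (x*v≡a⇒x≡a*u y[c-1]≡0 (*-g-1-inverseʳ c∈G c≢1)) (zeroˡ _)) y≢0
    where
    y[c-1]≡0 : y * (c - 1#) ≡ 0#
    y[c-1]≡0 = trans (*[g-1]≡*g-x y c) (trans (cong (_- y) yc≡y) (-‿inverseʳ y))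

  *-cancelˡ-∈G : ∀ {x g g′} → x ≢ 0# → g ∈ G → g′ ∈ G → x * g ≡ x * g′ → g ≡ g′
  *-cancelˡ-∈G {x} {g} {g′} x≢0 g∈G g′∈G xg≡xg′ = begin
    g                         ≡⟨ *-identityˡ g ⟨
    1# * g                    ≡⟨ cong (_* g) (*-inverseʳ g′∈G) ⟨
    g′ * inverse g′∈G * g     ≡⟨ *-assoc g′ (inverse g′∈G) g ⟩
    g′ * (inverse g′∈G * g)   ≡⟨ cong (g′ *_) g′⁻¹g≡1 ⟩
    g′ * 1#                   ≡⟨ *-identityʳ g′ ⟩
    g′                        ∎
    where
    g′⁻¹g≡1 : inverse g′∈G * g ≡ 1#
    g′⁻¹g≡1 = fixed⇒≡1 (∼-≢0 x≢0 (g′ , g′∈G , refl)) (*-closed (inverse-∈ g′∈G) g∈G) (begin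
      x * g′ * (inverse g′∈G * g)   ≡⟨ *-assoc (x * g′) (inverse g′∈G) g ⟨
      x * g′ * inverse g′∈G * g     ≡⟨ cong (_* g) (*-inverse-cancelʳ x g′∈G) ⟩
      x * g                         ≡⟨ xg≡xg′ ⟩
      x * g′                        ∎)

  orbit-size : ∀ {c} → c ≢ 0# → count (c ∼?_) ≡ ∣ G ∣
  orbit-size {c} c≢0 = trans (≤-antisym orbit≤G G≤orbit) (sym (∣p∣≡count G))
    where
    orbit≤G : count (c ∼?_) ≤ count (_∈? G)
    orbit≤G = count-≤-injection (c ∼?_) (_∈? G) (λ _ c∼x → proj₁ c∼x) (λ _ c∼x → proj₁ (proj₂ c∼x))
      λ { _ _ (_ , _ , cg≡x) (_ , _ , cg≡y) refl → trans (sym cg≡x) cg≡y }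
    G≤orbit : count (_∈? G) ≤ count (c ∼?_)
    G≤orbit = count-≤-injection (_∈? G) (c ∼?_) (λ g _ → c * g) (λ g g∈G → g , g∈G , refl)
      (λ _ _ g∈G g′∈G → *-cancelˡ-∈G c≢0 g∈G g′∈G)

  module _ {α} (α≢0 : α ≢ 0#) where

    Shifted : Fin n → Set
    Shifted x = x ≢ 0# × x ∼ x + α

    shifted? : ∀ x → Dec (Shifted x)
    shifted? x = ¬? (x ≟ 0#) ×-dec (x ∼? (x + α))

    *≡+⇒≢1 : ∀ {x g} → x * g ≡ x + α → g ≢ 1#
    *≡+⇒≢1 {x} {g} xg≡x+α g≡1 = α≢0 (begin
      α              ≡⟨ to *≡+⇔*[g-1]≡ xg≡x+α ⟨
      x * (g - 1#)   ≡⟨ cong (x *_) (x≈y⇒x∙y⁻¹≈ε g≡1) ⟩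
      x * 0#         ≡⟨ zeroʳ x ⟩
      0#             ∎)

    solution : ∀ {g} → g ∈ G → g ≢ 1# → Fin n
    solution g∈G g≢1 = α * g-1-inverse g∈G g≢1

    solution-solves : ∀ {g} (g∈G : g ∈ G) (g≢1 : g ≢ 1#) → solution g∈G g≢1 * (g - 1#) ≡ α
    solution-solves {g} g∈G g≢1 = begin
      α * g-1-inverse g∈G g≢1 * (g - 1#)     ≡⟨ *-assoc α _ (g - 1#) ⟩
      α * (g-1-inverse g∈G g≢1 * (g - 1#))   ≡⟨ cong (α *_) (*-g-1-inverseˡ g∈G g≢1) ⟩
      α * 1#                                 ≡⟨ *-identityʳ α ⟩
      α                                      ∎

    solution-≢0 : ∀ {g} (g∈G : g ∈ G) (g≢1 : g ≢ 1#) → solution g∈G g≢1 ≢ 0#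
    solution-≢0 {g} g∈G g≢1 x≡0 = α≢0 (begin
      α                              ≡⟨ solution-solves g∈G g≢1 ⟨
      solution g∈G g≢1 * (g - 1#)    ≡⟨ cong (_* (g - 1#)) x≡0 ⟩
      0# * (g - 1#)                  ≡⟨ zeroˡ (g - 1#) ⟩
      0#                             ∎)

    shifted-count : count shifted? ℕ.+ 1 ≡ ∣ G ∣
    shifted-count = begin
      count shifted? ℕ.+ 1                 ≡⟨ cong (ℕ._+ 1) (≤-antisym shifted≤G∖1 G∖1≤shifted) ⟩
      count G∖1? ℕ.+ 1                     ≡⟨ cong (count G∖1? ℕ.+_) (𝟙-yes (1# ∈? G) one∈G) ⟨
      count G∖1? ℕ.+ 𝟙 (1# ∈? G)          ≡⟨ count-split (_∈? G) 1# ⟨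
      count (_∈? G)                        ≡⟨ ∣p∣≡count G ⟨
      ∣ G ∣                                ∎
      where
      G∖1? : ∀ g → Dec (g ∈ G × g ≢ 1#)
      G∖1? g = (g ∈? G) ×-dec ¬? (g ≟ 1#)
      shifted≤G∖1 : count shifted? ≤ count G∖1?
      shifted≤G∖1 = count-≤-injection shifted? G∖1?
        (λ _ (_ , g , _) → g) (λ _ (_ , _ , g∈G , xg≡x+α) → g∈G , *≡+⇒≢1 xg≡x+α)
        λ { _ _ (_ , g , g∈G , xg≡x+α) (_ , _ , _ , x′g≡x′+α) refl →
            let [g-1]u≡1 = *-g-1-inverseʳ g∈G (*≡+⇒≢1 xg≡x+α) in
            trans (x*v≡a⇒x≡a*u (to *≡+⇔*[g-1]≡ xg≡x+α) [g-1]u≡1)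
                  (sym (x*v≡a⇒x≡a*u (to *≡+⇔*[g-1]≡ x′g≡x′+α) [g-1]u≡1)) }
      G∖1≤shifted : count G∖1? ≤ count shifted?
      G∖1≤shifted = count-≤-injection G∖1? shifted? (λ _ (g∈G , g≢1) → solution g∈G g≢1)
        (λ g (g∈G , g≢1) → solution-≢0 g∈G g≢1 , g , g∈G ,
                           from *≡+⇔*[g-1]≡ (solution-solves g∈G g≢1))
        λ g g′ (g∈G , g≢1) (g′∈G , g′≢1) x≡x′ → *-cancelˡ-∈G (solution-≢0 g∈G g≢1) g∈G g′∈G (begin
          solution g∈G g≢1 * g      ≡⟨ from *≡+⇔*[g-1]≡ (solution-solves g∈G g≢1) ⟩
          solution g∈G g≢1 + α      ≡⟨ cong (_+ α) x≡x′ ⟩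
          solution g′∈G g′≢1 + α    ≡⟨ from *≡+⇔*[g-1]≡ (solution-solves g′∈G g′≢1) ⟨
          solution g′∈G g′≢1 * g′   ≡⟨ cong (_* g′) x≡x′ ⟨
          solution g∈G g≢1 * g′     ∎)

module ZeroDifference {n} (R : FinRing n) (1≢0 : FinRing.1# R ≢ FinRing.0# R)
  (G : Subset n) (G-subgroup : IsMulSubgroup R G) (G-1-invertible : Cond R G)
  {d} (h : D R G ⤖ Fin d) where

  open FinRing R
  open IsMulSubgroup G-subgroup
  open SubgroupAction R G G-subgroup G-1-invertible
  open Ring ring using (+-identityˡ; -‿inverseˡ)
  open RingProperties ring using (+-inverseˡ-unique; -‿involutive)
  open ≡-Reasoning

  coset≡⇔∼ : ∀ {a b} → coset R G a ≡ coset R G b ⇔ a ∼ b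
  coset≡⇔∼ {a} {b} = mk⇔
    (λ aG≡bG → to (∈-tabulate⇔ (a ∼?_))
                 (subst (b ∈_) (sym aG≡bG) (from (∈-tabulate⇔ (b ∼?_)) (∼-refl b))))
    (λ a∼b → tabulate-cong (λ x → does-⇔ (mk⇔ (∼-trans (∼-sym a∼b)) (∼-trans a∼b)) (a ∼? x) (b ∼? x)))

  fG≡⇔∼ : ∀ {a b} → fG R G h a ≡ fG R G h b ⇔ a ∼ b
  fG≡⇔∼ = mk⇔
    (λ fa≡fb → to coset≡⇔∼ (cong proj₁ (Bijection.injective h fa≡fb)))
    (λ a∼b → cong (Bijection.to h) (D-≡ (from coset≡⇔∼ a∼b)))
    where
    D-≡ : ∀ {S S′ : Subset n} {p p′} → S ≡ S′ → _≡_ {A = D R G} (S , p) (S′ , p′)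
    D-≡ {p = p} {p′} refl = cong (_ ,_) (T-irrelevant p p′)

  f₀ : Fin n → Fin d
  f₀ = fG0 R G h

  f₀-≢0 : ∀ {x} → x ≢ 0# → f₀ x ≡ fG R G h x
  f₀-≢0 {x} x≢0 with x ≟ 0#
  ... | yes x≡0 = contradiction x≡0 x≢0
  ... | no _    = refl

  f₀-0 : f₀ 0# ≡ f₀ 1#
  f₀-0 = trans f₀0≡fG1 (sym (f₀-≢0 1≢0))
    where
    f₀0≡fG1 : f₀ 0# ≡ fG R G h 1#
    f₀0≡fG1 with 0# ≟ 0#
    ... | yes _  = refl
    ... | no 0≢0 = contradiction refl 0≢0

  by-zero : ∀ {Q : Fin n → Set ℓ} → Q 0# → (∀ {x} → x ≢ 0# → Q x) → ∀ x → Q x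
  by-zero q₀ q≢0 x with x ≟ 0#
  ... | yes refl = q₀
  ... | no x≢0   = q≢0 x≢0

  f₀≡⇔∼ : ∀ {a b} → a ≢ 0# → b ≢ 0# → f₀ a ≡ f₀ b ⇔ a ∼ b
  f₀≡⇔∼ {a} {b} a≢0 b≢0 = mk⇔
    (λ fa≡fb → to fG≡⇔∼ (trans (sym (f₀-≢0 a≢0)) (trans fa≡fb (f₀-≢0 b≢0))))
    (λ a∼b → trans (f₀-≢0 a≢0) (trans (from fG≡⇔∼ a∼b) (sym (f₀-≢0 b≢0))))

  f₀1≡⇔∈G : ∀ {a} → a ≢ 0# → f₀ 1# ≡ f₀ a ⇔ a ∈ G
  f₀1≡⇔∈G a≢0 = ⇔.trans (f₀≡⇔∼ 1≢0 a≢0) 1∼⇔∈G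

  -1≢0 : - 1# ≢ 0#
  -1≢0 = -‿≢0 1≢0

  nonzero-preimage : ∀ {x y} → f₀ x ≡ y → ∃ λ c → c ≢ 0# × f₀ c ≡ y
  nonzero-preimage {x} {y} = by-zero {Q = λ x → f₀ x ≡ y → ∃ λ c → c ≢ 0# × f₀ c ≡ y}
    (λ f₀0≡y → 1# , 1≢0 , trans (sym f₀-0) f₀0≡y) (λ x≢0 fx≡y → _ , x≢0 , fx≡y) x

  k : ℕ
  k = ∣ G ∣

  private instance
    k-nonZero : NonZero k
    k-nonZero = sizeNZ R G-subgroup

  q : ℕ
  q = (n ∸ 1) / k

  k≥1 : 1 ≤ k
  k≥1 = >-nonZero⁻¹ k

  nonzero-fibre? : ∀ y x → Dec (x ≢ 0# × f₀ x ≡ y)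
  nonzero-fibre? y x = ¬? (x ≟ 0#) ×-dec (f₀ x ≟ y)

  fibre-count : ∀ y → count (nonzero-fibre? y) ≡ 𝟙 (image? f₀ y) ℕ.* k
  fibre-count y with image? f₀ y
  ... | no ∉image = count-∅ (nonzero-fibre? y) (λ x (_ , fx≡y) → ∉image (x , fx≡y))
  ... | yes (_ , fx≡y) with nonzero-preimage fx≡y
  ...   | c , c≢0 , fc≡y = begin
    count (nonzero-fibre? y)   ≡⟨ count-cong (nonzero-fibre? y) (c ∼?_) fibre⇔orbit ⟩
    count (c ∼?_)              ≡⟨ orbit-size c≢0 ⟩
    k                          ≡⟨ ℕₚ.+-identityʳ k ⟨
    1 ℕ.* k                    ∎
    where
    fibre⇔orbit : ∀ x → (x ≢ 0# × f₀ x ≡ y) ⇔ c ∼ x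
    fibre⇔orbit x = mk⇔
      (λ (x≢0 , fx≡y) → to (f₀≡⇔∼ c≢0 x≢0) (trans fc≡y (sym fx≡y)))
      (λ c∼x → let x≢0 = ∼-≢0 c≢0 c∼x in
               x≢0 , trans (sym (from (f₀≡⇔∼ c≢0 x≢0) c∼x)) fc≡y)

  imageSize*k≡n∸1 : imageSize R f₀ ℕ.* k ≡ n ∸ 1
  imageSize*k≡n∸1 = begin
    count (image? f₀) ℕ.* k               ≡⟨ cong (ℕ._* k) (count≡∑𝟙 (image? f₀)) ⟩
    (∑[ y < d ] 𝟙 (image? f₀ y)) ℕ.* k    ≡⟨ *-distribʳ-sum k (𝟙 ∘ image? f₀) ⟩
    ∑[ y < d ] (𝟙 (image? f₀ y) ℕ.* k)    ≡⟨ sum-cong-≗ fibre-count ⟨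
    ∑[ y < d ] count (nonzero-fibre? y)   ≡⟨ ∑-count-fibres (λ x → ¬? (x ≟ 0#)) f₀ ⟩
    count (λ x → ¬? (x ≟ 0#))             ≡⟨ count-≢ 0# ⟩
    n ∸ 1                                 ∎

  imageSize≡q : imageSize R f₀ ≡ q
  imageSize≡q = trans (sym (m*n/n≡m (imageSize R f₀) k)) (cong (_/ k) imageSize*k≡n∸1)

  lam-formula : ∀ {α} → α ≢ 0# → lam R f₀ α ≡ (k ∸ 1) ℕ.+ 𝟙 (- α ∈? G) ℕ.+ 𝟙 (α ∈? G)
  lam-formula {α} α≢0 = begin
    lam R f₀ α
      ≡⟨ count-split P? 0# ⟩
    count P₀? ℕ.+ 𝟙 (P? 0#)
      ≡⟨ cong (ℕ._+ 𝟙 (P? 0#)) (count-split P₀? (- α)) ⟩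
    count P₀₁? ℕ.+ 𝟙 (P₀? (- α)) ℕ.+ 𝟙 (P? 0#)
      ≡⟨ cong₂ ℕ._+_ (cong₂ ℕ._+_ count-P₀₁ (𝟙-cong (P₀? (- α)) (- α ∈? G) at-−α))
                     (𝟙-cong (P? 0#) (α ∈? G) at-0) ⟩
    (k ∸ 1) ℕ.+ 𝟙 (- α ∈? G) ℕ.+ 𝟙 (α ∈? G)
      ∎
    where
    P? : ∀ x → Dec (f₀ (x + α) ≡ f₀ x)
    P? x = f₀ (x + α) ≟ f₀ x
    P₀? : ∀ x → Dec (f₀ (x + α) ≡ f₀ x × x ≢ 0#)
    P₀? x = P? x ×-dec ¬? (x ≟ 0#)
    P₀₁? : ∀ x → Dec ((f₀ (x + α) ≡ f₀ x × x ≢ 0#) × x ≢ - α)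
    P₀₁? x = P₀? x ×-dec ¬? (x ≟ - α)

    at-0 : f₀ (0# + α) ≡ f₀ 0# ⇔ α ∈ G
    at-0 = mk⇔
      (λ e → to (f₀1≡⇔∈G α≢0) (trans (sym f₀-0) (trans (sym e) (cong f₀ (+-identityˡ α)))))
      (λ α∈G → trans (cong f₀ (+-identityˡ α)) (trans (sym (from (f₀1≡⇔∈G α≢0) α∈G)) (sym f₀-0)))

    f₀[-α+α]≡f₀1 : f₀ (- α + α) ≡ f₀ 1#
    f₀[-α+α]≡f₀1 = trans (cong f₀ (-‿inverseˡ α)) f₀-0

    at-−α : (f₀ (- α + α) ≡ f₀ (- α) × - α ≢ 0#) ⇔ - α ∈ G
    at-−α = mk⇔
      (λ (e , _) → to (f₀1≡⇔∈G (-‿≢0 α≢0)) (trans (sym f₀[-α+α]≡f₀1) e))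
      (λ -α∈G → trans f₀[-α+α]≡f₀1 (from (f₀1≡⇔∈G (-‿≢0 α≢0)) -α∈G) , -‿≢0 α≢0)

    elsewhere : ∀ x → ((f₀ (x + α) ≡ f₀ x × x ≢ 0#) × x ≢ - α) ⇔ Shifted α≢0 x
    elsewhere x = mk⇔
      (λ ((e , x≢0) , x≢-α) →
         let x+α≢0 = x≢-α ∘ +-inverseˡ-unique x α in
         x≢0 , ∼-sym (to (f₀≡⇔∼ x+α≢0 x≢0) e))
      (λ (x≢0 , x∼x+α) →
         let x+α≢0 = ∼-≢0 x≢0 x∼x+α in
         (from (f₀≡⇔∼ x+α≢0 x≢0) (∼-sym x∼x+α) , x≢0) ,
         λ x≡-α → x+α≢0 (trans (cong (_+ α) x≡-α) (-‿inverseˡ α)))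

    count-P₀₁ : count P₀₁? ≡ k ∸ 1
    count-P₀₁ = begin
      count P₀₁?                        ≡⟨ count-cong P₀₁? (shifted? α≢0) elsewhere ⟩
      count (shifted? α≢0)              ≡⟨ m+n∸n≡m (count (shifted? α≢0)) 1 ⟨
      count (shifted? α≢0) ℕ.+ 1 ∸ 1    ≡⟨ cong (_∸ 1) (shifted-count α≢0) ⟩
      k ∸ 1                             ∎

  lam-by-membership : ∀ {α} (α≢0 : α ≢ 0#) {a b} → 𝟙 (- α ∈? G) ≡ a → 𝟙 (α ∈? G) ≡ b →
                      lam R f₀ α ≡ (k ∸ 1) ℕ.+ a ℕ.+ b
  lam-by-membership α≢0 refl refl = lam-formula α≢0

  lam-∈±G : ∀ {α} → α ≢ 0# → α ∈ G → - α ∈ G → lam R f₀ α ≡ k ℕ.+ 1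
  lam-∈±G {α} α≢0 α∈G -α∈G =
    trans (lam-by-membership α≢0 (𝟙-yes (- α ∈? G) -α∈G) (𝟙-yes (α ∈? G) α∈G))
          (cong (ℕ._+ 1) (m∸n+n≡m k≥1))

  lam-∉±G : ∀ {α} → α ≢ 0# → α ∉ G → - α ∉ G → lam R f₀ α ≡ k ∸ 1
  lam-∉±G {α} α≢0 α∉G -α∉G =
    trans (lam-by-membership α≢0 (𝟙-no (- α ∈? G) -α∉G) (𝟙-no (α ∈? G) α∉G))
          (trans (ℕₚ.+-identityʳ _) (ℕₚ.+-identityʳ _))

  lam-∈∓G : - 1# ∉ G → ∀ {α} → α ≢ 0# → α ∈ G ⊎ - α ∈ G → lam R f₀ α ≡ k
  lam-∈∓G -1∉G {α} α≢0 (inj₁ α∈G) =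
    trans (lam-by-membership α≢0 (𝟙-no (- α ∈? G) (-1∉G ∘ -∈G⇒-1∈G α∈G)) (𝟙-yes (α ∈? G) α∈G))
          (trans (cong (ℕ._+ 1) (ℕₚ.+-identityʳ (k ∸ 1))) (m∸n+n≡m k≥1))
  lam-∈∓G -1∉G {α} α≢0 (inj₂ -α∈G) =
    trans (lam-by-membership α≢0 (𝟙-yes (- α ∈? G) -α∈G) (𝟙-no (α ∈? G) (-1∉G ∘ flip -∈G⇒-1∈G -α∈G)))
          (trans (ℕₚ.+-identityʳ ((k ∸ 1) ℕ.+ 1)) (m∸n+n≡m k≥1))

  ∉G⇒2≤q : ∀ {α} → α ≢ 0# → α ∉ G → 2 ≤ q
  ∉G⇒2≤q α≢0 α∉G = subst (2 ≤_) imageSize≡q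
    (distinct⇒2≤imageSize f₀ (α∉G ∘ to (f₀1≡⇔∈G α≢0)))

  ∉±G⇒3≤q : - 1# ∉ G → ∀ {α} → α ≢ 0# → α ∉ G → - α ∉ G → 3 ≤ q
  ∉±G⇒3≤q -1∉G α≢0 α∉G -α∉G = subst (3 ≤_) imageSize≡q (distinct⇒3≤imageSize f₀
    (-1∉G ∘ to (f₀1≡⇔∈G -1≢0))
    (α∉G ∘ to (f₀1≡⇔∈G α≢0))
    (-α∉G ∘ to ∼-1⇔-∈G ∘ ∼-sym ∘ to (f₀≡⇔∼ -1≢0 α≢0)))

  ⊆G⇒q≤1 : (∀ {α} → α ≢ 0# → α ∈ G) → q ≤ 1
  ⊆G⇒q≤1 ⊆G = subst (_≤ 1) imageSize≡q (constant⇒imageSize≤1 f₀ {1#}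
    (by-zero f₀-0 (λ x≢0 → sym (from (f₀1≡⇔∈G x≢0) (⊆G x≢0)))))

  ⊆±G⇒q≤2 : (∀ {α} → α ≢ 0# → α ∈ G ⊎ - α ∈ G) → q ≤ 2
  ⊆±G⇒q≤2 ⊆±G = subst (_≤ 2) imageSize≡q (two-valued⇒imageSize≤2 f₀ {1#} { - 1#}
    (by-zero (inj₁ f₀-0) λ x≢0 → ⊎.map
      (sym ∘ from (f₀1≡⇔∈G x≢0))
      (from (f₀≡⇔∼ x≢0 -1≢0) ∘ from ∼-1⇔-∈G)
      (⊆±G x≢0)))

  2≤q⇒∃∉G : 2 ≤ q → ∃ λ α → α ≢ 0# × α ∉ G
  2≤q⇒∃∉G 2≤q with any? (λ α → ¬? (α ≟ 0#) ×-dec ¬? (α ∈? G))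
  ... | yes ∃α = ∃α
  ... | no ∄α  = contradiction
    (⊆G⇒q≤1 λ {α} α≢0 → decidable-stable (α ∈? G) (λ α∉G → ∄α (α , α≢0 , α∉G)))
    (<⇒≱ 2≤q)

  2<q⇒∃∉±G : 2 < q → ∃ λ α → α ≢ 0# × α ∉ G × - α ∉ G
  2<q⇒∃∉±G 2<q with any? (λ α → ¬? (α ≟ 0#) ×-dec (¬? (α ∈? G) ×-dec ¬? (- α ∈? G)))
  ... | yes ∃α = ∃α
  ... | no ∄α  = contradiction (⊆±G⇒q≤2 ⊆±G) (<⇒≱ 2<q)
    where
    ⊆±G : ∀ {α} → α ≢ 0# → α ∈ G ⊎ - α ∈ G
    ⊆±G {α} α≢0 with α ∈? G | - α ∈? G
    ... | yes α∈G | _        = inj₁ α∈G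
    ... | no _    | yes -α∈G = inj₂ -α∈G
    ... | no α∉G  | no -α∉G  = contradiction (α , α≢0 , α∉G , -α∉G) ∄α

  q≡1⇒⊆G : q ≡ 1 → ∀ {α} → α ≢ 0# → α ∈ G
  q≡1⇒⊆G q≡1 {α} α≢0 = decidable-stable (α ∈? G) λ α∉G → <⇒≱ (∉G⇒2≤q α≢0 α∉G) (≤-reflexive q≡1)

  q≡2⇒⊆±G : q ≡ 2 → - 1# ∉ G → ∀ {α} → α ≢ 0# → α ∈ G ⊎ - α ∈ G
  q≡2⇒⊆±G q≡2 -1∉G {α} α≢0 with α ∈? G | - α ∈? G
  ... | yes α∈G | _        = inj₁ α∈G
  ... | no _    | yes -α∈G = inj₂ -α∈G
  ... | no α∉G  | no -α∉G  = contradiction (≤-reflexive q≡2) (<⇒≱ (∉±G⇒3≤q -1∉G α≢0 α∉G -α∉G))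

  isZD-q≡1 : q ≡ 1 → IsZD R f₀ q (n ∷ [])
  isZD-q≡1 q≡1 = mkIsZD R f₀ imageSize≡q (λ α≢0 → here (lam≡n α≢0))
    λ { (here refl) → 1# , 1≢0 , lam≡n 1≢0 ; (there ()) }
    where
    k+1≡n : k ℕ.+ 1 ≡ n
    k+1≡n = begin
      k ℕ.+ 1                      ≡⟨ cong (ℕ._+ 1) (ℕₚ.*-identityˡ k) ⟨
      1 ℕ.* k ℕ.+ 1                ≡⟨ cong (λ m → m ℕ.* k ℕ.+ 1) (trans imageSize≡q q≡1) ⟨
      imageSize R f₀ ℕ.* k ℕ.+ 1   ≡⟨ cong (ℕ._+ 1) imageSize*k≡n∸1 ⟩
      n ∸ 1 ℕ.+ 1                  ≡⟨ m∸n+n≡m (>-nonZero⁻¹ n {{nonZeroIndex 0#}}) ⟩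
      n                            ∎
    lam≡n : ∀ {α} → α ≢ 0# → lam R f₀ α ≡ n
    lam≡n α≢0 = trans (lam-∈±G α≢0 (q≡1⇒⊆G q≡1 α≢0) (q≡1⇒⊆G q≡1 (-‿≢0 α≢0))) k+1≡n

  isZD-q≡2 : q ≡ 2 → - 1# ∉ G → IsZD R f₀ q (k ∷ [])
  isZD-q≡2 q≡2 -1∉G = mkIsZD R f₀ imageSize≡q
    (λ α≢0 → here (lam-∈∓G -1∉G α≢0 (q≡2⇒⊆±G q≡2 -1∉G α≢0)))
    λ { (here refl) → 1# , 1≢0 , lam-∈∓G -1∉G 1≢0 (inj₁ one∈G) ; (there ()) }

  isZD-2<q : 2 < q → - 1# ∉ G → IsZD R f₀ q (k ∸ 1 ∷ k ∷ [])
  isZD-2<q 2<q -1∉G = mkIsZD R f₀ imageSize≡q lam∈S λ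
    { (here refl)         → let (α , α≢0 , α∉G , -α∉G) = 2<q⇒∃∉±G 2<q in
                              α , α≢0 , lam-∉±G α≢0 α∉G -α∉G
    ; (there (here refl)) → 1# , 1≢0 , lam-∈∓G -1∉G 1≢0 (inj₁ one∈G)
    ; (there (there ())) }
    where
    lam∈S : ∀ {α} → α ≢ 0# → lam R f₀ α ∈ₗ k ∸ 1 ∷ k ∷ []
    lam∈S {α} α≢0 with α ∈? G | - α ∈? G
    ... | yes α∈G | _        = there (here (lam-∈∓G -1∉G α≢0 (inj₁ α∈G)))
    ... | no _    | yes -α∈G = there (here (lam-∈∓G -1∉G α≢0 (inj₂ -α∈G)))
    ... | no α∉G  | no -α∉G  = here (lam-∉±G α≢0 α∉G -α∉G)

  isZD-2≤q : 2 ≤ q → - 1# ∈ G → IsZD R f₀ q (k ∸ 1 ∷ k ℕ.+ 1 ∷ [])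
  isZD-2≤q 2≤q -1∈G = mkIsZD R f₀ imageSize≡q lam∈S λ
    { (here refl)         → let (α , α≢0 , α∉G) = 2≤q⇒∃∉G 2≤q in
                              α , α≢0 , lam-∉±G α≢0 α∉G (α∉G ∘ -∈G⇒∈G)
    ; (there (here refl)) → 1# , 1≢0 , lam-∈±G 1≢0 one∈G (-1∈G⇒-∈G -1∈G one∈G)
    ; (there (there ())) }
    where
    -∈G⇒∈G : ∀ {α} → - α ∈ G → α ∈ G
    -∈G⇒∈G {α} -α∈G = subst (_∈ G) (-‿involutive α) (-1∈G⇒-∈G -1∈G -α∈G)
    lam∈S : ∀ {α} → α ≢ 0# → lam R f₀ α ∈ₗ k ∸ 1 ∷ k ℕ.+ 1 ∷ []
    lam∈S {α} α≢0 with α ∈? G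
    ... | yes α∈G = there (here (lam-∈±G α≢0 α∈G (-1∈G⇒-∈G -1∈G α∈G)))
    ... | no α∉G  = here (lam-∉±G α≢0 α∉G (α∉G ∘ -∈G⇒∈G))

open import Data.Nat using (_+_)

theorem1 : ∀ {n} (R : FinRing n) → FinRing.1# R ≢ FinRing.0# R →
  (G : Subset n) (sg : IsMulSubgroup R G) → Cond R G →
  ∀ d (h : D R G ⤖ Fin d) →
  let k = ∣ G ∣
      q = _/_ (n ∸ 1) k {{sizeNZ R sg}}
      f = fG0 R G h
      m1∈G = FinRing.-_ R (FinRing.1# R) ∈ G
  in (q ≡ 1 → IsZD R f q (n ∷ []))
   × (q ≡ 2 → ¬ m1∈G → IsZD R f q (k ∷ []))
   × (2 < q → ¬ m1∈G → IsZD R f q (k ∸ 1 ∷ k ∷ []))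
   × (2 ≤ q → m1∈G → IsZD R f q (k ∸ 1 ∷ k + 1 ∷ []))
theorem1 R 1≢0 G sg cond d h = isZD-q≡1 , isZD-q≡2 , isZD-2<q , isZD-2≤q
  where open ZeroDifference R 1≢0 G sg cond h
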